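{- If $G$ is a finite Eulerian bipartite graph with no isolated vertices and maximum degree $\Delta(G)=4$, then $\check s(G)\leq 3$.
   Context: A graph is called Eulerian here if every vertex has even degree. For a proper edge coloring $\varphi$ of a graph $G$, the palette of a vertex $v$ is the set of colors on edges incident with $v$. The palette index $\check s(G)$ is the minimum number of distinct palettes over all proper edge colorings of $G$. -}

module Defs where

open import Data.Nat using (ℕ; _≤_)
open import Data.Nat.Divisibility using (_∣_)
open import Data.Bool using (Bool; T)
open import Data.Fin using (Fin)
open import Data.List using (List; length; filter)
open import Data.List.Base using (allFin)
open import Data.Bool.Properties using (T?)
open import Data.Product using (Σ; ∃; _×_)
open import Relation.Binary.PropositionalEquality using (_≡_; _≢_)
open import Function.Bundles using (_⇔_)

record Graph (n : ℕ) : Set where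
  field
    adj    : Fin n → Fin n → Bool
    symm   : ∀ u v → adj u v ≡ adj v u
    irrefl : ∀ v → adj v v ≡ Data.Bool.false
open Graph public

Adj : ∀ {n} → Graph n → Fin n → Fin n → Set
Adj G u v = T (adj G u v)

nbrs : ∀ {n} → Graph n → Fin n → List (Fin n)
nbrs {n} G u = filter (λ v → T? (adj G u v)) (allFin n)

deg : ∀ {n} → Graph n → Fin n → ℕ
deg G u = length (nbrs G u)

-- Eulerian (in the paper's sense): every vertex has even degree
Eulerian : ∀ {n} → Graph n → Set
Eulerian {n} G = ∀ (v : Fin n) → 2 ∣ deg G v

NoIsolated : ∀ {n} → Graph n → Set
NoIsolated {n} G = ∀ (v : Fin n) → 1 ≤ deg G v

MaxDegree : ∀ {n} → Graph n → ℕ → Set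
MaxDegree {n} G d = (∀ (v : Fin n) → deg G v ≤ d) × (∃ λ (v : Fin n) → deg G v ≡ d)

Bipartite : ∀ {n} → Graph n → Set
Bipartite {n} G = ∃ λ (side : Fin n → Bool) → ∀ u v → Adj G u v → side u ≢ side v

-- An edge colouring with colours in ℕ: col u v is the colour of edge uv
-- (values on non-edges are irrelevant).
record ProperEdgeColoring {n} (G : Graph n) : Set where
  field
    col    : Fin n → Fin n → ℕ
    col-sym : ∀ u v → Adj G u v → col u v ≡ col v u
    proper : ∀ u v w → Adj G u v → Adj G u w → v ≢ w → col u v ≢ col u w
open ProperEdgeColoring public

InPalette : ∀ {n} {G : Graph n} → ProperEdgeColoring G → Fin n → ℕ → Set
InPalette {G = G} φ v k = ∃ λ w → Adj G v w × col φ v w ≡ k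

SamePalette : ∀ {n} {G : Graph n} → ProperEdgeColoring G → Fin n → Fin n → Set
SamePalette φ u v = ∀ k → InPalette φ u k ⇔ InPalette φ v k

-- φ has at most m distinct palettes: there are m vertices whose palettes
-- cover all palettes occurring in φ
AtMostPalettes : ∀ {n} {G : Graph n} → ProperEdgeColoring G → ℕ → Set
AtMostPalettes {n} φ m =
  ∃ λ (r : Fin m → Fin n) → ∀ v → ∃ λ i → SamePalette φ v (r i)

PaletteIndex≤ : ∀ {n} → Graph n → ℕ → Set
PaletteIndex≤ G m = ∃ λ (φ : ProperEdgeColoring G) → AtMostPalettes φ m

module Submission where

-- All degrees are then 2 or 4.  We colour the edges with the four colours
-- (class, bit) ∈ Bool × Bool so that a vertex of degree 4 sees all four
-- colours and a vertex of degree 2 sees the two colours of a single bit b;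
-- hence at most three palettes occur.
--
-- The general tool (module PortGraph): a finite 2-regular multigraph, given by
-- a fixed-point-free involution on the ports (two per vertex), has an
-- orientation with one incoming and one outgoing port at every vertex; it is
-- built by deleting the vertices one at a time.  If the multigraph is
-- bipartite, shifting the orientation by the side yields a 2-edge-colouring
-- in which the two edges at every vertex differ.  Module Construction applies
-- this twice: to the split graph, whose vertices are the halves (pairs of
-- consecutive neighbours) of the vertices, which gives the class; and to the
-- class graph, whose vertex (v , c) carries the edges of class c at v, with
-- the two classes of a degree-2 vertex linked, which gives the bit.

open import Defs

open import Data.Bool using (Bool; true; false; not; _xor_; T)
import Data.Bool.Properties as Boolₚ
open import Data.Empty using (⊥-elim)
open import Data.Fin using (Fin)
import Data.Fin as Fin
import Data.Fin.Properties as Finₚ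
open import Data.List using (List; []; _∷_; length; cartesianProduct)
open import Data.List.Base using (allFin)
open import Data.List.Membership.Propositional using (_∈_)
open import Data.List.Membership.Propositional.Properties
  using (∈-filter⁺; ∈-filter⁻; ∈-allFin; ∈-cartesianProduct⁺)
open import Data.List.Relation.Unary.All using (lookup)
open import Data.List.Relation.Unary.AllPairs using (_∷_)
open import Data.List.Relation.Unary.Any using (here; there)
open import Data.List.Relation.Unary.Unique.Propositional using (Unique)
import Data.List.Relation.Unary.Unique.Propositional.Properties as Uniqueₚ
open import Data.Maybe using (Maybe; nothing; just)
import Data.Maybe.Properties as Maybeₚ
open import Data.Nat using (ℕ; zero; suc; _≤_; _<_; z≤n; s≤s)
open import Data.Nat.Divisibility using (_∣_; _∣?_)
open import Data.Nat.Properties using (<-≤-trans)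
open import Data.Product using (Σ; ∃; _×_; _,_; proj₁; proj₂)
open import Data.Product.Properties using (≡-dec)
open import Data.Sum using (_⊎_; inj₁; inj₂)
open import Data.Unit using (⊤; tt)
open import Function using (_∘_; case_of_)
open import Function.Bundles using (mk⇔)
open import Relation.Binary using (DecidableEquality)
open import Relation.Binary.PropositionalEquality
  using (_≡_; _≢_; refl; sym; trans; cong; cong₂; subst; module ≡-Reasoning)
open import Relation.Nullary using (Dec; yes; no)
open import Relation.Nullary.Decidable using (T?; from-no)

≢⇒not : ∀ {a b} → a ≢ b → b ≡ not a
≢⇒not {false} {false} p = ⊥-elim (p refl)
≢⇒not {false} {true}  _ = refl
≢⇒not {true}  {false} _ = refl
≢⇒not {true}  {true}  p = ⊥-elim (p refl)

xor-not : ∀ c a → c xor a ≢ not c xor a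
xor-not false a = Boolₚ.not-¬ refl
xor-not true  a = Boolₚ.not-¬ refl ∘ sym

xor-≢ : ∀ {a b c d} → a ≢ b → c ≢ d → a xor c ≡ b xor d
xor-≢ {a} {c = c} a≢b c≢d
  rewrite ≢⇒not a≢b | ≢⇒not c≢d = sym (Boolₚ.xor-annihilates-not a c)

xor-cancelˡ : ∀ c {a b} → c xor a ≡ c xor b → a ≡ b
xor-cancelˡ false e = e
xor-cancelˡ true  e = Boolₚ.not-injective e

xor-cancelʳ : ∀ c {a b} → a xor c ≡ b xor c → a ≡ b
xor-cancelʳ c {a} {b} e = xor-cancelˡ c (trans (Boolₚ.xor-comm c a) (trans e (Boolₚ.xor-comm b c)))

xor-twice : ∀ c a → (c xor a) xor a ≡ c
xor-twice c a = begin
  (c xor a) xor a ≡⟨ Boolₚ.xor-assoc c a a ⟩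
  c xor (a xor a) ≡⟨ cong (c xor_) (Boolₚ.xor-same a) ⟩
  c xor false     ≡⟨ Boolₚ.xor-identityʳ c ⟩
  c               ∎
  where open ≡-Reasoning

module PortGraph {V : Set} (_≟_ : DecidableEquality V) where

  Port : Set
  Port = V × Bool

  vertex : Port → V
  vertex = proj₁

  -- A 2-regular multigraph on the active vertices: each edge is a pair
  -- {x , mate x} of distinct ports (loops joining the two ports of a vertex
  -- are allowed).
  record Pairing : Set₁ where
    field
      Active       : V → Set
      mate         : Port → Port
      mate-active  : ∀ x → Active (vertex x) → Active (vertex (mate x))
      mate-invol   : ∀ x → Active (vertex x) → mate (mate x) ≡ x
      mate-fixfree : ∀ x → Active (vertex x) → mate x ≢ x

    mate-injective : ∀ x y → Active (vertex x) → Active (vertex y) → mate x ≡ mate y → x ≡ y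
    mate-injective x y ax ay e = trans (sym (mate-invol x ax)) (trans (cong mate e) (mate-invol y ay))

  value : (V → Bool) → Port → Bool
  value t (u , i) = i xor t u

  -- An orientation: the two ends of every edge get opposite values (read the
  -- value true as "outgoing"), so each vertex has one incoming and one
  -- outgoing port.
  Orientation : Pairing → Set
  Orientation P = Σ (V → Bool) λ t →
    ∀ x → Pairing.Active P (vertex x) → value t x ≢ value t (Pairing.mate P x)

  -- A 2-edge-colouring: both ends of every edge get the same value, and the two
  -- edges at a vertex get different colours.
  TwoColouring : Pairing → Set
  TwoColouring P = Σ (V → Bool) λ t →
    ∀ x → Pairing.Active P (vertex x) → value t x ≡ value t (Pairing.mate P x)

  -- Deleting a vertex v from a pairing: an edge that used to enter v now
  -- continues through the other port of v ("bypasses" v).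
  module Deletion (P : Pairing) (v : V) where
    open Pairing P using (Active; mate; mate-active; mate-invol; mate-fixfree; mate-injective)

    bypass : Port → Port
    bypass (u , c) with u ≟ v
    ... | yes _ = mate (v , not c)
    ... | no _  = (u , c)

    bypass-at : ∀ c → bypass (v , c) ≡ mate (v , not c)
    bypass-at c with v ≟ v
    ... | yes _   = refl
    ... | no v≢v  = ⊥-elim (v≢v refl)

    bypass-off : ∀ y → vertex y ≢ v → bypass y ≡ y
    bypass-off (u , c) u≢v with u ≟ v
    ... | yes u≡v = ⊥-elim (u≢v u≡v)
    ... | no _    = refl

    data Landing (x : Port) : Set where
      away : vertex (mate x) ≢ v → Landing x
      at   : ∀ c → mate x ≡ (v , c) → Landing x

    landing : ∀ x → Landing x
    landing x with vertex (mate x) ≟ v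
    ... | yes e = at (proj₂ (mate x)) (cong (_, proj₂ (mate x)) e)
    ... | no ne = away ne

    mate-at-v : ∀ c → Active v → vertex (mate (v , c)) ≡ v → mate (v , c) ≡ (v , not c)
    mate-at-v c av e = cong₂ _,_ e (≢⇒not (λ c≡ → mate-fixfree (v , c) av (cong₂ _,_ e (sym c≡))))

    module Entering (x : Port) (ax : Active (vertex x)) (x≢v : vertex x ≢ v)
                    (c : Bool) (mx : mate x ≡ (v , c)) where
      av : Active v
      av = subst (Active ∘ vertex) mx (mate-active x ax)

      x-is-mate : mate (v , c) ≡ x
      x-is-mate = trans (cong mate (sym mx)) (mate-invol x ax)

      exit : Port
      exit = mate (v , not c)

      bypass-mate : bypass (mate x) ≡ exit
      bypass-mate = trans (cong bypass mx) (bypass-at c)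

      exit-active : Active (vertex exit)
      exit-active = mate-active (v , not c) av

      exit-away : vertex exit ≢ v
      exit-away e = x≢v (cong vertex (begin
        x                      ≡⟨ x-is-mate ⟨
        mate (v , c)           ≡⟨ cong (λ b → mate (v , b)) (Boolₚ.not-involutive c) ⟨
        mate (v , not (not c)) ≡⟨ cong mate (mate-at-v (not c) av e) ⟨
        mate exit              ≡⟨ mate-invol (v , not c) av ⟩
        (v , not c)            ∎))
        where open ≡-Reasoning

      exit≢x : exit ≢ x
      exit≢x e = Boolₚ.not-¬ refl (sym (cong proj₂ (mate-injective (v , not c) (v , c) av av
                   (trans e (sym x-is-mate)))))

    Remaining : V → Set
    Remaining u = Active u × u ≢ v

    deleted-mate : Port → Port
    deleted-mate = bypass ∘ mate

    deleted-active : ∀ x → Remaining (vertex x) → Remaining (vertex (deleted-mate x))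
    deleted-active x (ax , x≢v) with landing x
    ... | away ne  = subst (Remaining ∘ vertex) (sym (bypass-off (mate x) ne)) (mate-active x ax , ne)
    ... | at c mx  = subst (Remaining ∘ vertex) (sym bypass-mate) (exit-active , exit-away)
      where open Entering x ax x≢v c mx

    deleted-invol : ∀ x → Remaining (vertex x) → deleted-mate (deleted-mate x) ≡ x
    deleted-invol x (ax , x≢v) with landing x
    ... | away ne = begin
      bypass (mate (bypass (mate x))) ≡⟨ cong (bypass ∘ mate) (bypass-off (mate x) ne) ⟩
      bypass (mate (mate x))          ≡⟨ cong bypass (mate-invol x ax) ⟩
      bypass x                        ≡⟨ bypass-off x x≢v ⟩
      x                               ∎
      where open ≡-Reasoning
    ... | at c mx = begin
      bypass (mate (bypass (mate x))) ≡⟨ cong (bypass ∘ mate) bypass-mate ⟩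
      bypass (mate exit)              ≡⟨ cong bypass (mate-invol (v , not c) av) ⟩
      bypass (v , not c)              ≡⟨ bypass-at (not c) ⟩
      mate (v , not (not c))          ≡⟨ cong (λ b → mate (v , b)) (Boolₚ.not-involutive c) ⟩
      mate (v , c)                    ≡⟨ x-is-mate ⟩
      x                               ∎
      where open ≡-Reasoning
            open Entering x ax x≢v c mx

    deleted-fixfree : ∀ x → Remaining (vertex x) → deleted-mate x ≢ x
    deleted-fixfree x (ax , x≢v) with landing x
    ... | away ne = mate-fixfree x ax ∘ trans (sym (bypass-off (mate x) ne))
    ... | at c mx = exit≢x ∘ trans (sym bypass-mate)
      where open Entering x ax x≢v c mx

    deleted : Pairing
    deleted = record
      { Active       = Remaining
      ; mate         = deleted-mate
      ; mate-active  = deleted-active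
      ; mate-invol   = deleted-invol
      ; mate-fixfree = deleted-fixfree
      }

    module Extension (o : Orientation deleted) where
      t' : V → Bool
      t' = proj₁ o

      t : V → Bool
      t u with u ≟ v
      ... | yes _ = not (value t' (mate (v , false)))
      ... | no _  = t' u

      t-at : t v ≡ not (value t' (mate (v , false)))
      t-at with v ≟ v
      ... | yes _  = refl
      ... | no v≢v = ⊥-elim (v≢v refl)

      value-off : ∀ y → vertex y ≢ v → value t y ≡ value t' y
      value-off (u , i) u≢v with u ≟ v
      ... | yes u≡v = ⊥-elim (u≢v u≡v)
      ... | no _    = refl

      entering : ∀ y → Active (vertex y) → vertex y ≢ v →
                 ∀ c → mate y ≡ (v , c) → value t y ≢ value t (v , c)
      entering y ay y≢v false my e = Boolₚ.not-¬ refl (begin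
          value t' y                       ≡⟨ value-off y y≢v ⟨
          value t y                        ≡⟨ e ⟩
          t v                              ≡⟨ t-at ⟩
          not (value t' (mate (v , false))) ≡⟨ cong (not ∘ value t') x-is-mate ⟩
          not (value t' y)                 ∎)
        where open ≡-Reasoning
              open Entering y ay y≢v false my
      entering y ay y≢v true my e = proj₂ o y (ay , y≢v) (begin
          value t' y                       ≡⟨ value-off y y≢v ⟨
          value t y                        ≡⟨ e ⟩
          not (t v)                        ≡⟨ cong not t-at ⟩
          not (not (value t' (mate (v , false)))) ≡⟨ Boolₚ.not-involutive _ ⟩
          value t' (mate (v , false))      ≡⟨ cong (value t') bypass-mate ⟨
          value t' (deleted-mate y)        ∎)
        where open ≡-Reasoning
              open Entering y ay y≢v true my

      oriented-at : ∀ c → Active v → value t (v , c) ≢ value t (mate (v , c))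
      oriented-at c av with landing (v , c)
      ... | away ne = λ e → entering (mate (v , c)) (mate-active (v , c) av) ne c
                              (mate-invol (v , c) av) (sym e)
      ... | at d mx = subst (λ y → value t (v , c) ≢ value t y)
                        (sym (mate-at-v c av (cong vertex mx))) (xor-not c (t v))

      oriented-off : ∀ x → Active (vertex x) → vertex x ≢ v → value t x ≢ value t (mate x)
      oriented-off x ax x≢v with landing x
      ... | away ne = λ e → proj₂ o x (ax , x≢v) (begin
          value t' x                ≡⟨ value-off x x≢v ⟨
          value t x                 ≡⟨ e ⟩
          value t (mate x)          ≡⟨ value-off (mate x) ne ⟩
          value t' (mate x)         ≡⟨ cong (value t') (bypass-off (mate x) ne) ⟨
          value t' (deleted-mate x) ∎)
        where open ≡-Reasoning
      ... | at d mx = subst (λ y → value t x ≢ value t y) (sym mx) (entering x ax x≢v d mx)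

      oriented : ∀ x → Active (vertex x) → value t x ≢ value t (mate x)
      oriented (u , c) au = by-cases (u ≟ v)
        where
        by-cases : Dec (u ≡ v) → value t (u , c) ≢ value t (mate (u , c))
        by-cases (yes u≡v) = subst (λ w → Active w → value t (w , c) ≢ value t (mate (w , c)))
                               (sym u≡v) (oriented-at c) au
        by-cases (no u≢v)  = oriented-off (u , c) au u≢v

      orientation : Orientation P
      orientation = t , oriented

  orient : (L : List V) (P : Pairing) → (∀ u → Pairing.Active P u → u ∈ L) → Orientation P
  orient []      P cover = (λ _ → false) , λ x ax → case cover (vertex x) ax of λ ()
  orient (v ∷ L) P cover = Extension.orientation (orient L deleted cover-rest)
    where
    open Deletion P v
    cover-rest : ∀ u → Remaining u → u ∈ L
    cover-rest u (au , u≢v) with cover u au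
    ... | here u≡v  = ⊥-elim (u≢v u≡v)
    ... | there u∈L = u∈L

  -- If paired ports always lie on opposite sides of a bipartition, shifting an
  -- orientation by the side turns it into a 2-colouring in which paired ports agree.
  twoColour : (L : List V) (P : Pairing) → (∀ u → Pairing.Active P u → u ∈ L) →
              (side : V → Bool) →
              (∀ x → Pairing.Active P (vertex x) → side (vertex (Pairing.mate P x)) ≢ side (vertex x)) →
              TwoColouring P
  twoColour L P cover side crossing = t , balanced
    where
    open Pairing P using (Active; mate)
    o : Orientation P
    o = orient L P cover

    t : V → Bool
    t u = proj₁ o u xor side u

    shift : ∀ x → value t x ≡ value (proj₁ o) x xor side (vertex x)
    shift (u , i) = sym (Boolₚ.xor-assoc i (proj₁ o u) (side u))

    balanced : ∀ x → Active (vertex x) → value t x ≡ value t (mate x)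
    balanced x ax = begin
      value t x                                       ≡⟨ shift x ⟩
      value (proj₁ o) x xor side (vertex x)           ≡⟨ xor-≢ (proj₂ o x ax) (crossing x ax ∘ sym) ⟩
      value (proj₁ o) (mate x) xor side (vertex (mate x)) ≡⟨ shift (mate x) ⟨
      value t (mate x)                                ∎
      where open ≡-Reasoning

module ListPosition {A : Set} (_≟_ : DecidableEquality A) where

  -- The element at position i (a default value d for out-of-range positions).
  nth : List A → ℕ → A → A
  nth []       _       d = d
  nth (x ∷ xs) zero    d = x
  nth (x ∷ xs) (suc i) d = nth xs i d

  indexOf : A → List A → ℕ
  indexOf x [] = 0
  indexOf x (y ∷ ys) with x ≟ y
  ... | yes _ = 0
  ... | no _  = suc (indexOf x ys)

  nth-∈ : ∀ xs i d → i < length xs → nth xs i d ∈ xs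
  nth-∈ (x ∷ xs) zero    d _       = here refl
  nth-∈ (x ∷ xs) (suc i) d (s≤s p) = there (nth-∈ xs i d p)

  indexOf-< : ∀ {x} xs → x ∈ xs → indexOf x xs < length xs
  indexOf-< {x} (y ∷ ys) x∈ with x ≟ y
  indexOf-< {x} (y ∷ ys) x∈         | yes _ = s≤s z≤n
  indexOf-< {x} (y ∷ ys) (here x≡y) | no x≢y = ⊥-elim (x≢y x≡y)
  indexOf-< {x} (y ∷ ys) (there x∈) | no _   = s≤s (indexOf-< ys x∈)

  nth-indexOf : ∀ {x} xs d → x ∈ xs → nth xs (indexOf x xs) d ≡ x
  nth-indexOf {x} (y ∷ ys) d x∈ with x ≟ y
  nth-indexOf {x} (y ∷ ys) d x∈         | yes x≡y = sym x≡y
  nth-indexOf {x} (y ∷ ys) d (here x≡y) | no x≢y  = ⊥-elim (x≢y x≡y)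
  nth-indexOf {x} (y ∷ ys) d (there x∈) | no _    = nth-indexOf ys d x∈

  indexOf-nth : ∀ xs i d → Unique xs → i < length xs → indexOf (nth xs i d) xs ≡ i
  indexOf-nth (y ∷ ys) zero d _ _ with y ≟ y
  ... | yes _  = refl
  ... | no y≢y = ⊥-elim (y≢y refl)
  indexOf-nth (y ∷ ys) (suc i) d (y∉ys ∷ u) (s≤s p) with nth ys i d ≟ y
  ... | yes e = ⊥-elim (lookup y∉ys (nth-∈ ys i d p) (sym e))
  ... | no _  = cong suc (indexOf-nth ys i d u p)

-- Positions 0…3 are coded by two bits: the half (positions {0,1} or {2,3})
-- and the bit within the half.
code : Bool → Bool → ℕ
code false false = 0
code false true  = 1
code true  false = 2
code true  true  = 3

codeHalf : ℕ → Bool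
codeHalf 0 = false
codeHalf 1 = false
codeHalf _ = true

codeBit : ℕ → Bool
codeBit 0             = false
codeBit 1             = true
codeBit (suc (suc p)) = codeBit p

code-split : ∀ p → p < 4 → code (codeHalf p) (codeBit p) ≡ p
code-split 0 _ = refl
code-split 1 _ = refl
code-split 2 _ = refl
code-split 3 _ = refl
code-split (suc (suc (suc (suc p)))) (s≤s (s≤s (s≤s (s≤s ()))))

code-parts : ∀ h l → (codeHalf (code h l) , codeBit (code h l)) ≡ (h , l)
code-parts false false = refl
code-parts false true  = refl
code-parts true  false = refl
code-parts true  true  = refl

code<4 : ∀ h l → code h l < 4
code<4 false false = s≤s z≤n
code<4 false true  = s≤s (s≤s z≤n)
code<4 true  false = s≤s (s≤s (s≤s z≤n))
code<4 true  true  = s≤s (s≤s (s≤s (s≤s z≤n)))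

code-false<2 : ∀ l → code false l < 2
code-false<2 false = s≤s z≤n
code-false<2 true  = s≤s (s≤s z≤n)

codeHalf<2 : ∀ p → p < 2 → codeHalf p ≡ false
codeHalf<2 0 _ = refl
codeHalf<2 1 _ = refl
codeHalf<2 (suc (suc p)) (s≤s (s≤s ()))

code-injective : ∀ {h l h' l'} → code h l ≡ code h' l' → h ≡ h' × l ≡ l'
code-injective {h} {l} {h'} {l'} e =
  let parts = trans (sym (code-parts h l)) (trans (cong (λ p → codeHalf p , codeBit p) e) (code-parts h' l'))
  in cong proj₁ parts , cong proj₂ parts

module Construction {n : ℕ} (G : Graph n)
                    (deg-2-or-4 : ∀ v → deg G v ≡ 2 ⊎ deg G v ≡ 4)
                    (side : Fin n → Bool) (bipartite : ∀ u v → Adj G u v → side u ≢ side v) where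

  open ListPosition (Fin._≟_ {n})

  nbr : Fin n → ℕ → Fin n
  nbr v i = nth (nbrs G v) i v

  slot : Fin n → Fin n → ℕ
  slot v w = indexOf w (nbrs G v)

  adj-∈ : ∀ v w → Adj G v w → w ∈ nbrs G v
  adj-∈ v w a = ∈-filter⁺ (λ u → T? (adj G v u)) (∈-allFin w) a

  nbr-adj : ∀ v i → i < deg G v → Adj G v (nbr v i)
  nbr-adj v i i<d = proj₂ (∈-filter⁻ (λ u → T? (adj G v u)) {xs = allFin n} (nth-∈ (nbrs G v) i v i<d))

  nbr-slot : ∀ v w → Adj G v w → nbr v (slot v w) ≡ w
  nbr-slot v w a = nth-indexOf (nbrs G v) v (adj-∈ v w a)

  slot-nbr : ∀ v i → i < deg G v → slot v (nbr v i) ≡ i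
  slot-nbr v i i<d = indexOf-nth (nbrs G v) i v
                       (Uniqueₚ.filter⁺ (λ u → T? (adj G v u)) (Uniqueₚ.allFin⁺ n)) i<d

  slot<deg : ∀ v w → Adj G v w → slot v w < deg G v
  slot<deg v w a = indexOf-< (nbrs G v) (adj-∈ v w a)

  adj-sym : ∀ v w → Adj G v w → Adj G w v
  adj-sym v w a = subst T (symm G v w) a

  wide : Fin n → Bool
  wide v with deg-2-or-4 v
  ... | inj₁ _ = false
  ... | inj₂ _ = true

  wide-deg : ∀ v → wide v ≡ true → deg G v ≡ 4
  wide-deg v wd with deg-2-or-4 v
  ... | inj₂ d = d

  narrow-deg : ∀ v → wide v ≡ false → deg G v ≡ 2
  narrow-deg v nw with deg-2-or-4 v
  ... | inj₁ d = d

  2≤deg : ∀ v → 2 ≤ deg G v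
  2≤deg v with deg-2-or-4 v
  ... | inj₁ d = subst (2 ≤_) (sym d) (s≤s (s≤s z≤n))
  ... | inj₂ d = subst (2 ≤_) (sym d) (s≤s (s≤s z≤n))

  slot<4 : ∀ v w → Adj G v w → slot v w < 4
  slot<4 v w a with deg-2-or-4 v
  ... | inj₁ d = <-≤-trans (subst (slot v w <_) d (slot<deg v w a)) (s≤s (s≤s z≤n))
  ... | inj₂ d = subst (slot v w <_) d (slot<deg v w a)

  -- Every vertex v is split into the half (v , false), holding the neighbours
  -- at positions 0 and 1, and, if v is wide, the half (v , true), holding
  -- positions 2 and 3.
  Half : Set
  Half = Fin n × Bool

  halfActive : Half → Bool
  halfActive (v , false) = true
  halfActive (v , true)  = wide v

  halves : List Half
  halves = cartesianProduct (allFin n) (false ∷ true ∷ [])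

  ∈-halves : ∀ x → x ∈ halves
  ∈-halves (v , false) = ∈-cartesianProduct⁺ (∈-allFin v) (here refl)
  ∈-halves (v , true)  = ∈-cartesianProduct⁺ (∈-allFin v) (there (here refl))

  code<deg : ∀ v h l → halfActive (v , h) ≡ true → code h l < deg G v
  code<deg v false l _ = <-≤-trans (code-false<2 l) (2≤deg v)
  code<deg v true  l a = subst (code true l <_) (sym (wide-deg v a)) (code<4 true l)

  wide-active : ∀ {v} → wide v ≡ true → ∀ h → halfActive (v , h) ≡ true
  wide-active wd false = refl
  wide-active wd true  = wd

  narrow-half : ∀ v w → wide v ≡ false → Adj G v w → codeHalf (slot v w) ≡ false
  narrow-half v w nw a = codeHalf<2 (slot v w) (subst (slot v w <_) (narrow-deg v nw) (slot<deg v w a))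

  slot-active : ∀ v w → Adj G v w → halfActive (v , codeHalf (slot v w)) ≡ true
  slot-active v w a with wide v in e
  ... | true  = wide-active e (codeHalf (slot v w))
  ... | false = cong (λ h → halfActive (v , h)) (narrow-half v w e a)

  open PortGraph (≡-dec (Fin._≟_ {n}) Boolₚ._≟_)

  -- The split graph: the port of the edge vw at v is the position of w among
  -- the neighbours of v, coded as (half, bit).
  splitPort : Fin n → Fin n → Port
  splitPort v w = (v , codeHalf (slot v w)) , codeBit (slot v w)

  splitMate : Port → Port
  splitMate ((v , h) , l) = splitPort (nbr v (code h l)) v

  SplitActive : Half → Set
  SplitActive x = halfActive x ≡ true

  split-edges : (Q : Port → Set) → (∀ v w → Adj G v w → Q (splitPort v w)) →
                ∀ x → SplitActive (vertex x) → Q x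
  split-edges Q q ((v , h) , l) a = subst Q (sym x≡port) (q v (nbr v (code h l)) (nbr-adj v _ in-range))
    where
    in-range : code h l < deg G v
    in-range = code<deg v h l a
    x≡port : ((v , h) , l) ≡ splitPort v (nbr v (code h l))
    x≡port = trans (cong (λ p → (v , proj₁ p) , proj₂ p) (sym (code-parts h l)))
                   (cong (λ s → (v , codeHalf s) , codeBit s) (sym (slot-nbr v (code h l) in-range)))

  splitMate-port : ∀ v w → Adj G v w → splitMate (splitPort v w) ≡ splitPort w v
  splitMate-port v w a = trans (cong (λ p → splitPort (nbr v p) v) (code-split (slot v w) (slot<4 v w a)))
                               (cong (λ u → splitPort u v) (nbr-slot v w a))

  -- The split graph is bipartite: a half lies on the side of its vertex.
  split-crossing : ∀ x → SplitActive (vertex x) →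
                   side (proj₁ (vertex (splitMate x))) ≢ side (proj₁ (vertex x))
  split-crossing = split-edges _ λ v w a →
    subst (λ y → side (proj₁ (vertex y)) ≢ side v) (sym (splitMate-port v w a))
          (bipartite w v (adj-sym v w a))

  split : Pairing
  split = record
    { Active       = SplitActive
    ; mate         = splitMate
    ; mate-active  = split-edges _ λ v w a →
                       subst (SplitActive ∘ vertex) (sym (splitMate-port v w a))
                             (slot-active w v (adj-sym v w a))
    ; mate-invol   = split-edges _ λ v w a →
                       trans (cong splitMate (splitMate-port v w a)) (splitMate-port w v (adj-sym v w a))
    ; mate-fixfree = λ x ax e → split-crossing x ax (cong (side ∘ proj₁ ∘ vertex) e)
    }

  -- First colouring layer: each edge gets a class so that the two edges in an
  -- active half have different classes.
  colouring₁ : TwoColouring split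
  colouring₁ = twoColour halves split (λ x _ → ∈-halves x) (side ∘ proj₁) split-crossing

  t₁ : Half → Bool
  t₁ = proj₁ colouring₁

  class : Fin n → Fin n → Bool
  class v w = value t₁ (splitPort v w)

  class-sym : ∀ v w → Adj G v w → class v w ≡ class w v
  class-sym v w a = trans (proj₂ colouring₁ (splitPort v w) (slot-active v w a))
                          (cong (value t₁) (splitMate-port v w a))

  -- The class graph: the vertex (v , c) collects the edges of class c at v, one
  -- from each active half; it is a port graph on the same vertex type.  The port
  -- of the edge vw at (v , c) is the half of v containing w.
  classPort : Fin n → Fin n → Bool → Port
  classPort v w c = (v , c) , codeHalf (slot v w)

  classNbr : Fin n → Bool → Bool → Fin n
  classNbr v c g = nbr v (code g (c xor t₁ (v , g)))

  -- For a narrow vertex the missing port of (v , c) is linked to the missing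
  -- port of (v , not c).
  classMateBy : Bool → Fin n → Bool → Bool → Port
  classMateBy true  v c g = classPort (classNbr v c g) v c
  classMateBy false v c g = (v , not c) , g

  classMate : Port → Port
  classMate ((v , c) , g) = classMateBy (halfActive (v , g)) v c g

  edge-of-class : ∀ v c g → SplitActive (v , g) →
    Adj G v (classNbr v c g) × class v (classNbr v c g) ≡ c × codeHalf (slot v (classNbr v c g)) ≡ g
  edge-of-class v c g a = nbr-adj v s in-range , class≡c , half≡g
    where
    b = c xor t₁ (v , g)
    s = code g b
    in-range : s < deg G v
    in-range = code<deg v g b a
    slot≡s : slot v (classNbr v c g) ≡ s
    slot≡s = slot-nbr v s in-range
    half≡g : codeHalf (slot v (classNbr v c g)) ≡ g
    half≡g = trans (cong codeHalf slot≡s) (cong proj₁ (code-parts g b))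
    class≡c : class v (classNbr v c g) ≡ c
    class≡c = begin
      codeBit (slot v (classNbr v c g)) xor t₁ (v , codeHalf (slot v (classNbr v c g)))
        ≡⟨ cong₂ (λ l h → l xor t₁ (v , h))
                 (trans (cong codeBit slot≡s) (cong proj₂ (code-parts g b))) half≡g ⟩
      b xor t₁ (v , g)
        ≡⟨ xor-twice c (t₁ (v , g)) ⟩
      c ∎
      where open ≡-Reasoning

  classNbr-slot : ∀ v w → Adj G v w → classNbr v (class v w) (codeHalf (slot v w)) ≡ w
  classNbr-slot v w a = begin
    nbr v (code h (class v w xor t₁ (v , h)))
      ≡⟨ cong (λ l → nbr v (code h l)) (xor-twice (codeBit (slot v w)) (t₁ (v , h))) ⟩
    nbr v (code h (codeBit (slot v w)))       ≡⟨ cong (nbr v) (code-split (slot v w) (slot<4 v w a)) ⟩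
    nbr v (slot v w)                          ≡⟨ nbr-slot v w a ⟩
    w ∎
    where open ≡-Reasoning
          h = codeHalf (slot v w)

  classMate-port : ∀ v w → Adj G v w → classMate (classPort v w (class v w)) ≡ classPort w v (class v w)
  classMate-port v w a = begin
    classMateBy (halfActive (v , codeHalf (slot v w))) v (class v w) (codeHalf (slot v w))
      ≡⟨ cong (λ b → classMateBy b v (class v w) (codeHalf (slot v w))) (slot-active v w a) ⟩
    classPort (classNbr v (class v w) (codeHalf (slot v w))) v (class v w)
      ≡⟨ cong (λ u → classPort u v (class v w)) (classNbr-slot v w a) ⟩
    classPort w v (class v w) ∎
    where open ≡-Reasoning

  classMate-link : ∀ v c g → halfActive (v , g) ≡ false → classMate ((v , c) , g) ≡ ((v , not c) , g)
  classMate-link v c g l = cong (λ b → classMateBy b v c g) l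

  class-ports : (Q : Port → Set) → (∀ v w → Adj G v w → Q (classPort v w (class v w))) →
                (∀ v c g → halfActive (v , g) ≡ false → Q ((v , c) , g)) → ∀ x → Q x
  class-ports Q edge link ((v , c) , g) = by-cases (halfActive (v , g)) refl
    where
    by-cases : ∀ b → halfActive (v , g) ≡ b → Q ((v , c) , g)
    by-cases false l = link v c g l
    by-cases true  a =
      let (is-adj , class≡c , half≡g) = edge-of-class v c g a
      in subst Q (cong₂ (λ k h → (v , k) , h) class≡c half≡g) (edge v (classNbr v c g) is-adj)

  -- The class graph is bipartite with (v , c) on the side c xor side v; a link
  -- joins (v , c) and (v , not c), which lie on opposite sides.
  classSide : Half → Bool
  classSide (v , c) = c xor side v

  class-crossing : ∀ x → classSide (vertex (classMate x)) ≢ classSide (vertex x)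
  class-crossing = class-ports _
    (λ v w a → subst (λ y → classSide (vertex y) ≢ classSide (v , class v w)) (sym (classMate-port v w a))
                     (bipartite w v (adj-sym v w a) ∘ xor-cancelˡ (class v w)))
    (λ v c g l → subst (λ y → classSide (vertex y) ≢ classSide (v , c)) (sym (classMate-link v c g l))
                       (xor-not c (side v) ∘ sym))

  class-invol : ∀ x → classMate (classMate x) ≡ x
  class-invol = class-ports _
    (λ v w a → trans (cong classMate (classMate-port v w a))
                     (subst (λ k → classMate (classPort w v k) ≡ classPort v w k) (sym (class-sym v w a))
                            (classMate-port w v (adj-sym v w a))))
    (λ v c g l → begin
       classMate (classMate ((v , c) , g)) ≡⟨ cong classMate (classMate-link v c g l) ⟩
       classMate ((v , not c) , g)         ≡⟨ classMate-link v (not c) g l ⟩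
       (v , not (not c)) , g               ≡⟨ cong (λ k → (v , k) , g) (Boolₚ.not-involutive c) ⟩
       (v , c) , g                         ∎)
    where open ≡-Reasoning

  classGraph : Pairing
  classGraph = record
    { Active       = λ _ → ⊤
    ; mate         = classMate
    ; mate-active  = λ _ _ → tt
    ; mate-invol   = λ x _ → class-invol x
    ; mate-fixfree = λ x _ e → class-crossing x (cong (classSide ∘ vertex) e)
    }

  -- Second colouring layer: each edge gets a bit so that the two edges of the
  -- same class at a wide vertex have different bits.
  colouring₂ : TwoColouring classGraph
  colouring₂ = twoColour halves classGraph (λ x _ → ∈-halves x) classSide (λ x _ → class-crossing x)

  t₂ : Half → Bool
  t₂ = proj₁ colouring₂

  bit : Fin n → Fin n → Bool
  bit v w = value t₂ (classPort v w (class v w))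

  bit-sym : ∀ v w → Adj G v w → bit v w ≡ bit w v
  bit-sym v w a = begin
    bit v w                              ≡⟨ proj₂ colouring₂ (classPort v w (class v w)) tt ⟩
    value t₂ (classMate (classPort v w (class v w))) ≡⟨ cong (value t₂) (classMate-port v w a) ⟩
    value t₂ (classPort w v (class v w)) ≡⟨ cong (λ k → value t₂ (classPort w v k)) (class-sym v w a) ⟩
    bit w v                              ∎
    where open ≡-Reasoning

  -- The link at a narrow vertex forces both classes at v to get the same bit.
  narrow-t₂ : ∀ v → wide v ≡ false → ∀ c → t₂ (v , c) ≡ t₂ (v , false)
  narrow-t₂ v nw false = refl
  narrow-t₂ v nw true  = sym (Boolₚ.not-injective (begin
    not (t₂ (v , false))                     ≡⟨ proj₂ colouring₂ ((v , false) , true) tt ⟩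
    value t₂ (classMate ((v , false) , true)) ≡⟨ cong (value t₂) (classMate-link v false true nw) ⟩
    not (t₂ (v , true))                      ∎))
    where open ≡-Reasoning

  narrow-bit : ∀ v w → wide v ≡ false → Adj G v w → bit v w ≡ t₂ (v , false)
  narrow-bit v w nw a = trans (cong (_xor t₂ (v , class v w)) (narrow-half v w nw a))
                              (narrow-t₂ v nw (class v w))

  colour : Fin n → Fin n → ℕ
  colour v w = code (class v w) (bit v w)

  colour-injective : ∀ u v w → Adj G u v → Adj G u w → colour u v ≡ colour u w → v ≡ w
  colour-injective u v w av aw e = begin
    v                ≡⟨ nbr-slot u v av ⟨
    nbr u (slot u v) ≡⟨ cong (nbr u) slot≡ ⟩
    nbr u (slot u w) ≡⟨ nbr-slot u w aw ⟩
    w                ∎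
    where
    open ≡-Reasoning
    class≡ = proj₁ (code-injective e)
    half≡ : codeHalf (slot u v) ≡ codeHalf (slot u w)
    half≡ = xor-cancelʳ (t₂ (u , class u w))
              (trans (cong (λ k → codeHalf (slot u v) xor t₂ (u , k)) (sym class≡))
                     (proj₂ (code-injective e)))
    codeBit≡ : codeBit (slot u v) ≡ codeBit (slot u w)
    codeBit≡ = xor-cancelʳ (t₁ (u , codeHalf (slot u w)))
              (trans (cong (λ h → codeBit (slot u v) xor t₁ (u , h)) (sym half≡)) class≡)
    slot≡ : slot u v ≡ slot u w
    slot≡ = trans (sym (code-split (slot u v) (slot<4 u v av)))
              (trans (cong₂ code half≡ codeBit≡) (code-split (slot u w) (slot<4 u w aw)))

  φ : ProperEdgeColoring G
  φ = record
    { col     = colour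
    ; col-sym = λ v w a → cong₂ code (class-sym v w a) (bit-sym v w a)
    ; proper  = λ u v w av aw v≢w e → v≢w (colour-injective u v w av aw e)
    }

  -- The kind of a vertex: wide, or narrow with the bit b on both of its edges.
  kind : Fin n → Maybe Bool
  kind v with wide v
  ... | true  = nothing
  ... | false = just (t₂ (v , false))

  Allowed : Maybe Bool → Bool → Set
  Allowed nothing  _  = ⊤
  Allowed (just b) b' = b' ≡ b

  PaletteOf : Maybe Bool → ℕ → Set
  PaletteOf κ k = Σ Bool λ c → Σ Bool λ b → k ≡ code c b × Allowed κ b

  colour-in-half : ∀ v c g → SplitActive (v , g) → InPalette φ v (code c (g xor t₂ (v , c)))
  colour-in-half v c g a =
    let (is-adj , class≡c , half≡g) = edge-of-class v c g a
    in classNbr v c g , is-adj , cong₂ (λ k h → code k (h xor t₂ (v , k))) class≡c half≡g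

  palette-sound : ∀ v k → InPalette φ v k → PaletteOf (kind v) k
  palette-sound v k (w , a , e) = class v w , bit v w , sym e , allowed
    where
    allowed : Allowed (kind v) (bit v w)
    allowed with wide v in nw
    ... | true  = tt
    ... | false = narrow-bit v w nw a

  palette-complete : ∀ v k → PaletteOf (kind v) k → InPalette φ v k
  palette-complete v k (c , b , refl , al) with wide v in nw
  ... | true  = subst (λ b' → InPalette φ v (code c b')) (xor-twice b (t₂ (v , c)))
                  (colour-in-half v c (b xor t₂ (v , c)) (wide-active nw (b xor t₂ (v , c))))
  ... | false = subst (λ b' → InPalette φ v (code c b')) (trans (narrow-t₂ v nw c) (sym al))
                  (colour-in-half v c false refl)

  same-kind-same-palette : ∀ u v → kind u ≡ kind v → SamePalette φ u v
  same-kind-same-palette u v e k = mk⇔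
    (λ p → palette-complete v k (subst (λ κ → PaletteOf κ k) e (palette-sound u k p)))
    (λ p → palette-complete u k (subst (λ κ → PaletteOf κ k) (sym e) (palette-sound v k p)))

  -- There are only three kinds, so a representative of each kind covers all palettes.
  kinds : Fin 3 → Maybe Bool
  kinds Fin.zero                    = nothing
  kinds (Fin.suc Fin.zero)          = just false
  kinds (Fin.suc (Fin.suc Fin.zero)) = just true

  kindIndex : Maybe Bool → Fin 3
  kindIndex nothing      = Fin.zero
  kindIndex (just false) = Fin.suc Fin.zero
  kindIndex (just true)  = Fin.suc (Fin.suc Fin.zero)

  kinds-kindIndex : ∀ κ → kinds (kindIndex κ) ≡ κ
  kinds-kindIndex nothing      = refl
  kinds-kindIndex (just false) = refl
  kinds-kindIndex (just true)  = refl

  representative : Fin n → Maybe Bool → Fin n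
  representative d κ with Finₚ.any? (λ u → Maybeₚ.≡-dec Boolₚ._≟_ (kind u) κ)
  ... | yes (u , _) = u
  ... | no _        = d

  representative-kind : ∀ d u → kind (representative d (kind u)) ≡ kind u
  representative-kind d u with Finₚ.any? (λ u' → Maybeₚ.≡-dec Boolₚ._≟_ (kind u') (kind u))
  ... | yes (_ , e) = e
  ... | no none     = ⊥-elim (none (u , refl))

  three-palettes : Fin n → PaletteIndex≤ G 3
  three-palettes d = φ , (λ i → representative d (kinds i)) , covered
    where
    covered : ∀ u → ∃ λ i → SamePalette φ u (representative d (kinds i))
    covered u = kindIndex (kind u) , same-kind-same-palette u _ (sym (begin
      kind (representative d (kinds (kindIndex (kind u))))
        ≡⟨ cong (kind ∘ representative d) (kinds-kindIndex (kind u)) ⟩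
      kind (representative d (kind u))                     ≡⟨ representative-kind d u ⟩
      kind u                                               ∎))
      where open ≡-Reasoning

even-degree-2-or-4 : ∀ m → 2 ∣ m → 1 ≤ m → m ≤ 4 → m ≡ 2 ⊎ m ≡ 4
even-degree-2-or-4 0 _    () _
even-degree-2-or-4 1 even _ _ = ⊥-elim (from-no (2 ∣? 1) even)
even-degree-2-or-4 2 _    _ _ = inj₁ refl
even-degree-2-or-4 3 even _ _ = ⊥-elim (from-no (2 ∣? 3) even)
even-degree-2-or-4 4 _    _ _ = inj₂ refl
even-degree-2-or-4 (suc (suc (suc (suc (suc m))))) _ _ (s≤s (s≤s (s≤s (s≤s ()))))

corollary3p1 : ∀ {n : ℕ} (G : Graph n) → Eulerian G → Bipartite G → NoIsolated G →
    MaxDegree G 4 → PaletteIndex≤ G 3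
corollary3p1 G eulerian (side , bipartite) no-isolated (deg≤4 , (v₄ , _)) =
  Construction.three-palettes G
    (λ v → even-degree-2-or-4 (deg G v) (eulerian v) (no-isolated v) (deg≤4 v))
    side bipartite v₄
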